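{- For every $k\in\mathbb N$ there exists a $\Pi$-graph that is a generalised halved Farey graph and does not contain the Farey graph as a $k$-bounded minor.
   Context: All graphs are simple. A graph (with at least two vertices) is infinitely edge-connected if no two vertices are separated by deleting finitely many edges. A $\Pi$-graph is an infinitely edge-connected graph that does not contain infinitely many independent (internally vertex-disjoint) paths between any two of its vertices. A $k$-bounded minor is a minor all of whose branch sets have size less than $k$. Halved Farey graph: $\breve F_0=K^2$ with blue edge; $\breve F_{n+1}$ arises from $\breve F_n$ by adding for each blue edge $e$ a new vertex joined by two blue edges to the ends of $e$ and recolouring old edges black; $\breve F=\bigcup_n\breve F_n$. The Farey graph is the union of two copies of $\breve F$ intersecting exactly in $\breve F_0$. A generalised halved Farey graph of order $0$ is a non-trivial path with blue edges; one of order $n+1$ is obtained from one $G_n$ of order $n$ by adding, for every blue edge $e=uv$ of $G_n$, a blue $u$--$v$ path of length at least two internally disjoint from $G_n$ and from the other added paths, and recolouring the edges of $G_n$ black; the colourless union of such a sequence is a generalised halved Farey graph. -}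

module Defs where

open import Data.Nat using (ℕ; zero; suc; _<_; _≤_; _≟_)
open import Data.Bool using (Bool; true; false; if_then_else_)
open import Data.List using (List; []; _∷_; _++_; length)
open import Data.List.Membership.Propositional using (_∈_; _∉_)
open import Data.List.Relation.Unary.Linked using (Linked)
open import Data.List.Relation.Unary.Unique.Propositional using (Unique)
open import Data.Product using (Σ; _×_; _,_; proj₁; proj₂)
open import Data.Sum using (_⊎_)
open import Data.Unit using (⊤)
open import Data.Empty using (⊥)
open import Relation.Nullary using (¬_; does)
open import Relation.Binary.PropositionalEquality using (_≡_; _≢_)

-- Graphs (possibly infinite). Simplicity: the edge relation is a
-- relation on vertices (no multi-edges); the concrete graphs below are
-- symmetric and loopless by construction.

record Graph : Set₁ where
  field
    V : Set
    E : V → V → Set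

-- A u–v path (u ≠ v) whose consecutive vertices are R-related:
-- vertex sequence u ∷ I ++ [v] with no repeated vertex; I = interior.
PathIn : {V : Set} → (V → V → Set) → V → V → Set
PathIn {V} R u v =
  Σ (List V) λ I → Linked R (u ∷ I ++ v ∷ []) × Unique (u ∷ I ++ v ∷ [])

module _ (G : Graph) where
  open Graph G

  Path : V → V → Set
  Path = PathIn E

  EMinus : List (V × V) → V → V → Set
  EMinus F x y = E x y × (x , y) ∉ F × (y , x) ∉ F

  Separated : V → V → List (V × V) → Set
  Separated u v F = ¬ PathIn (EMinus F) u v

  InfinitelyEdgeConnected : Set
  InfinitelyEdgeConnected =
    (Σ V λ u → Σ V λ v → u ≢ v) ×
    (∀ u v → u ≢ v → ∀ (F : List (V × V)) → ¬ Separated u v F)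

  Independent : ∀ {u v} → Path u v → Path u v → Set
  Independent P Q = ∀ x → x ∈ proj₁ P → x ∈ proj₁ Q → ⊥

  InfIndepPaths : V → V → Set
  InfIndepPaths u v =
    Σ (ℕ → Path u v) λ f →
      (∀ i j → proj₁ (f i) ≡ proj₁ (f j) → i ≡ j) ×
      (∀ i j → i ≢ j → Independent (f i) (f j))

  IsΠGraph : Set
  IsΠGraph = InfinitelyEdgeConnected ×
             ¬ (Σ V λ u → Σ V λ v → InfIndepPaths u v)

record BoundedMinor (k : ℕ) (H G : Graph) : Set where
  private
    module H = Graph H
    module G = Graph G
  field
    B        : H.V → List G.V
    unique   : ∀ x → Unique (B x)
    nonempty : ∀ x → 0 < length (B x)
    small    : ∀ x → length (B x) < k
    connected : ∀ x u v → u ∈ B x → v ∈ B x → u ≢ v →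
                PathIn (λ a b → G.E a b × a ∈ B x × b ∈ B x) u v
    disjoint : ∀ x y → x ≢ y → ∀ v → v ∈ B x → v ∈ B y → ⊥
    edges    : ∀ x y → H.E x y →
               Σ G.V λ a → Σ G.V λ b → a ∈ B x × b ∈ B y × G.E a b

-- Vertices: the two vertices left, right of F̆₀ and, for
-- each side s (copy of the halved Farey graph) and each blue edge with
-- address a (a reversed list of bits), the vertex mid s a added on it.

data FV : Set where
  left right : FV
  mid : Bool → List Bool → FV

-- ends of the blue edge with (reversed) address a in copy s;
-- [] is the edge of F̆₀, and the two blue edges created from edge a
-- by adding mid s a are false ∷ a and true ∷ a.
fends : Bool → List Bool → FV × FV
fends s [] = left , right
fends s (false ∷ a) = proj₁ (fends s a) , mid s a
fends s (true ∷ a) = mid s a , proj₂ (fends s a)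

-- every edge of F̆ is blue at some stage
Farey : Graph
Farey = record
  { V = FV
  ; E = λ x y → Σ Bool λ s → Σ (List Bool) λ a →
          fends s a ≡ (x , y) ⊎ fends s a ≡ (y , x)
  }

-- Edge addresses are reversed lists of ℕ.
-- The address [] is a virtual edge between gleft and gright; the
-- order-0 path is the path "added" to it, of length L [] ≥ 1.
-- For a blue edge with address a ≠ [] a path of length L a ≥ 2 is
-- added; its edges get addresses i ∷ a (i < L a), its internal
-- vertices are ginner a j (j + 1 < L a).

data GV : Set where
  gleft gright : GV
  ginner : List ℕ → ℕ → GV

module GHF (L : List ℕ → ℕ) where

  ValidA : List ℕ → Set
  ValidA [] = ⊤
  ValidA (i ∷ a) = i < L a × ValidA a

  ValidV : GV → Set
  ValidV gleft = ⊤
  ValidV gright = ⊤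
  ValidV (ginner a j) = ValidA a × suc j < L a

  mutual
    ends : List ℕ → GV × GV
    ends [] = gleft , gright
    ends (i ∷ a) = pt a i , pt a (suc i)

    -- k-th vertex (0 ≤ k ≤ L a) of the path added for edge a
    pt : List ℕ → ℕ → GV
    pt a zero = proj₁ (ends a)
    pt a (suc k) = if does (suc k ≟ L a) then proj₂ (ends a) else ginner a k

record GHFParams : Set where
  field
    L    : List ℕ → ℕ
    base : 1 ≤ L []
    step : ∀ i a → GHF.ValidA L (i ∷ a) → 2 ≤ L (i ∷ a)

-- the generalised halved Farey graph determined by the parameters
-- (every generalised halved Farey graph is isomorphic to one of these)
GHFGraph : GHFParams → Graph
GHFGraph P = record
  { V = Σ GV ValidV
  ; E = λ x y → Σ (List ℕ) λ a → a ≢ [] × ValidA a ×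
          (ends a ≡ (proj₁ x , proj₁ y) ⊎ ends a ≡ (proj₁ y , proj₁ x))
  }
  where open GHFParams P
        open GHF L

-- Take the generalised halved Farey graph in which every added path has length n + 2, and let the
-- depth of a vertex be the stage at which it was added.  It is infinitely edge-connected because
-- an edge can always be replaced by the path added on it, so any two vertices are joined by walks
-- avoiding all edges between vertices of bounded depth.  The vertices below an edge r are
-- separated from the rest of the graph by the two ends of r, and if r is long only one of them
-- is shallow; hence every u–v path has an interior vertex of small depth, or none at all, and
-- there are only finitely many of those.  Finally, the deepest vertex of a cycle forces the cycle
-- to follow the whole path that created it, so every cycle has more than n vertices, whereas a
-- triangle of the Farey graph with branch sets of size below k yields a cycle on fewer than 3k
-- vertices; take n = 3k.
module Submission where

open import Defs
open import Data.Bool using (false; true; if_then_else_)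
open import Data.Empty using (⊥; ⊥-elim)
open import Data.Fin using (toℕ)
import Data.Fin.Properties as Fin
open import Data.Fin.Properties using (pigeonhole; toℕ<n; toℕ-injective)
open import Data.List using (List; []; _∷_; _++_; [_]; length; lookup; take; drop; map; concatMap; upTo)
open import Data.List.Extrema.Nat using (argmax; argmax-all; f[⊥]≤f[argmax]; f[xs]≤f[argmax])
open import Data.List.Membership.Propositional using (_∈_; _∉_; find)
open import Data.List.Membership.Propositional.Properties
  using (∈-∃++; ∈-++⁺ˡ; ∈-++⁺ʳ; ∈-++⁻; ∈-map⁺; ∈-map⁻; ∈-concatMap⁺; ∈-upTo⁺; finite)
open import Data.List.Properties using (≡-dec; ++-assoc; length-++; length-map; take++drop≡id; length-drop)
open import Data.List.Relation.Binary.Disjoint.Propositional using (Disjoint)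
open import Data.List.Relation.Binary.Subset.Propositional.Properties using () renaming (map⁺ to ⊆-map⁺)
open import Data.List.Relation.Unary.All as All using (All; []; _∷_)
import Data.List.Relation.Unary.All.Properties as All
open import Data.List.Relation.Unary.All.Properties using (¬Any⇒All¬)
open import Data.List.Relation.Unary.AllPairs using ([]; _∷_)
open import Data.List.Relation.Unary.Any as Any using (Any; here; there; index; any?)
open import Data.List.Relation.Unary.Any.Properties using (lookup-index)
open import Data.List.Relation.Unary.Linked as Linked using (Linked; []; [-]; _∷_)
open import Data.List.Relation.Unary.Unique.Propositional using (Unique)
import Data.List.Relation.Unary.Unique.Propositional.Properties as Unique
open import Data.Maybe using (Maybe; just; nothing)
open import Data.Maybe.Properties using (just-injective)
open import Data.Nat using (ℕ; zero; suc; _+_; _*_; _∸_; _≤_; _<_; s≤s; z≤n)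
import Data.Nat as ℕ
open import Data.Nat.Properties
  using ( ≤-refl; ≤-reflexive; ≤-trans; <-trans; ≤-pred; <⇒≤; <⇒≢; <⇒≱; ≰⇒>; ≤∧≢⇒<
        ; 1+n≰n; n<1+n; m≤n⇒m≤1+n; m<n⇒m<1+n; m≤m+n; m≤n+m; +-mono-≤; +-identityʳ; +-suc
        ; m∸[m∸n]≡n; <-irrelevant; module ≤-Reasoning )
import Data.Product as Product
open import Data.Product using (Σ; ∃; ∃₂; _×_; _,_; proj₁; proj₂)
open import Data.Sum as Sum using (_⊎_; inj₁; inj₂)
open import Function using (_∘_)
open import Function.Bundles using (mk↣)
open import Relation.Binary.Construct.Closure.ReflexiveTransitive as Star using (Star; ε; _◅_; _◅◅_)
open import Relation.Binary.Definitions using (DecidableEquality; Symmetric)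
open import Relation.Binary.PropositionalEquality using (_≡_; _≢_; refl; sym; trans; cong; cong₂; subst)
open import Relation.Nullary using (¬_; Dec; yes; no)
import Relation.Nullary.Decidable as Dec
open import Relation.Nullary.Decidable using (dec-true; dec-false)

module _ {A : Set} where

  lastOf : A → List A → A
  lastOf x []       = x
  lastOf _ (y ∷ ys) = lastOf y ys

  lastOf-++ : ∀ z P x (B : List A) → lastOf z (P ++ x ∷ B) ≡ lastOf x B
  lastOf-++ z []      x B = refl
  lastOf-++ z (p ∷ P) x B = lastOf-++ p P x B

  lastOf-∈ : ∀ x xs → lastOf x xs ∈ x ∷ xs
  lastOf-∈ x []       = here refl
  lastOf-∈ x (y ∷ ys) = there (lastOf-∈ y ys)

  ∷≡++[lastOf] : ∀ x xs → ∃ λ I → x ∷ xs ≡ I ++ [ lastOf x xs ]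
  ∷≡++[lastOf] x [] = [] , refl
  ∷≡++[lastOf] x (y ∷ ys) with I , eq ← ∷≡++[lastOf] y ys = x ∷ I , cong (x ∷_) eq

  Linked-++⁻ʳ : ∀ {R : A → A → Set} P {B} → Linked R (P ++ B) → Linked R B
  Linked-++⁻ʳ []      l = l
  Linked-++⁻ʳ (p ∷ P) l = Linked-++⁻ʳ P (Linked.tail l)

  Linked-++⁺ : ∀ {R : A → A → Set} x xs y ys → Linked R (x ∷ xs) → R (lastOf x xs) y →
               Linked R (y ∷ ys) → Linked R (x ∷ xs ++ y ∷ ys)
  Linked-++⁺ x []         y ys [-]      r l = r ∷ l
  Linked-++⁺ x (x′ ∷ xs) y ys (r′ ∷ l′) r l = r′ ∷ Linked-++⁺ x′ xs y ys l′ r l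

  Linked⇒lastOf-R : ∀ {R : A → A → Set} p P y B → Linked R (p ∷ P ++ y ∷ B) → R (lastOf p P) y
  Linked⇒lastOf-R p []      y B (r ∷ _) = r
  Linked⇒lastOf-R p (q ∷ P) y B (_ ∷ l) = Linked⇒lastOf-R q P y B l

  Unique-++⁻ʳ : ∀ P {B : List A} → Unique (P ++ B) → Unique B
  Unique-++⁻ʳ []      u       = u
  Unique-++⁻ʳ (p ∷ P) (_ ∷ u) = Unique-++⁻ʳ P u

  Unique-++⇒≢ : ∀ P {B : List A} {a b} → Unique (P ++ B) → a ∈ P → b ∈ B → a ≢ b
  Unique-++⇒≢ (p ∷ P) (p∉ ∷ _) (here refl) b∈ = All.lookup p∉ (∈-++⁺ʳ P b∈)
  Unique-++⇒≢ (p ∷ P) (_ ∷ u)  (there a∈)  b∈ = Unique-++⇒≢ P u a∈ b∈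

  record SimpleWalk (R : A → A → Set) (x y : A) : Set where
    constructor simpleWalk
    field
      next   : List A
      linked : Linked R (x ∷ next)
      unique : Unique (x ∷ next)
      lastIs : lastOf x next ≡ y

    vertices : List A
    vertices = x ∷ next

  open SimpleWalk public

  SimpleWalk⇒PathIn : ∀ {R : A → A → Set} {x y} → x ≢ y → SimpleWalk R x y → PathIn R x y
  SimpleWalk⇒PathIn x≢y (simpleWalk [] _ _ refl) = ⊥-elim (x≢y refl)
  SimpleWalk⇒PathIn {R} {x} x≢y (simpleWalk (z ∷ zs) l u refl)
    with I , eq ← ∷≡++[lastOf] z zs =
    I , subst (λ t → Linked R (x ∷ t)) eq l , subst (λ t → Unique (x ∷ t)) eq u

  module _ (_≟_ : DecidableEquality A) where
    open import Data.List.Membership.DecPropositional _≟_ using (_∈?_)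

    -- Loop erasure: if the rest of the walk revisits x, cut it back to that visit.
    Star⇒SimpleWalk : ∀ {R : A → A → Set} {x y} → Star R x y → SimpleWalk R x y
    Star⇒SimpleWalk ε = simpleWalk [] [-] ([] ∷ []) refl
    Star⇒SimpleWalk {R} {x} (_◅_ {j = y} r w)
      with simpleWalk ys l u e ← Star⇒SimpleWalk w | x ∈? (y ∷ ys)
    ... | no x∉ =
      simpleWalk (y ∷ ys) (r ∷ l)
                 (All.tabulate (λ z∈ x≡z → x∉ (subst (_∈ y ∷ ys) (sym x≡z) z∈)) ∷ u) e
    ... | yes x∈ with P , B , eq ← ∈-∃++ x∈ =
      simpleWalk B (Linked-++⁻ʳ P (subst (Linked R) eq l)) (Unique-++⁻ʳ P (subst Unique eq u))
                   (trans (sym (lastOf-split P eq)) e)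
      where
        lastOf-split : ∀ P {B} → y ∷ ys ≡ P ++ x ∷ B → lastOf y ys ≡ lastOf x B
        lastOf-split []      refl = refl
        lastOf-split (p ∷ P) refl = lastOf-++ p P x _

  record IsCycle (R : A → A → Set) (x : A) (xs : List A) : Set where
    field
      linked : Linked R (x ∷ xs)
      unique : Unique (x ∷ xs)
      closed : R (lastOf x xs) x
      long   : 2 ≤ length xs

  TwoNeighboursIn : (A → A → Set) → List A → A → Set
  TwoNeighboursIn R C y = Σ A λ p → Σ A λ q → p ∈ C × q ∈ C × p ≢ q × R y p × R y q

  cycle-neighbours : ∀ {R : A → A → Set} → Symmetric R → ∀ {x xs} → IsCycle R x xs →
                     ∀ {y} → y ∈ x ∷ xs → TwoNeighboursIn R (x ∷ xs) y
  cycle-neighbours {R} sym-R {x} {xs} cyc {y} y∈ = split (∈-∃++ y∈) C.long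
    where
      module C = IsCycle cyc
      split : (∃₂ λ P B → x ∷ xs ≡ P ++ y ∷ B) → 2 ≤ length xs → TwoNeighboursIn R (x ∷ xs) y
      split ([] , [] , refl) ()
      split ([] , z ∷ [] , refl) (s≤s ())
      split ([] , z ∷ w ∷ B , refl) _ =
        z , lastOf w B , there (here refl) , there (there (lastOf-∈ w B)) ,
        Unique-++⇒≢ [ z ] (Unique-++⁻ʳ [ y ] C.unique) (here refl) (lastOf-∈ w B) ,
        Linked.head C.linked , sym-R C.closed
      split (p ∷ P , z ∷ B , refl) _ =
        lastOf p P , z , ∈-++⁺ˡ (lastOf-∈ p P) , ∈-++⁺ʳ (p ∷ P) (there (here refl)) ,
        Unique-++⇒≢ (p ∷ P) C.unique (lastOf-∈ p P) (there (here refl)) ,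
        sym-R (Linked⇒lastOf-R p P y (z ∷ B) C.linked) , Linked.head (Linked-++⁻ʳ (p ∷ P) C.linked)
      split (p ∷ [] , [] , refl) (s≤s ())
      split (p ∷ w ∷ P , [] , refl) _ =
        lastOf w P , p , there (∈-++⁺ˡ (lastOf-∈ w P)) , here refl ,
        (λ eq → Unique-++⇒≢ [ p ] C.unique (here refl) (∈-++⁺ˡ (lastOf-∈ w P)) (sym eq)) ,
        sym-R (Linked⇒lastOf-R p (w ∷ P) y [] C.linked) ,
        subst (λ t → R t p) (lastOf-++ p (w ∷ P) y []) C.closed

  2≤length : ∀ P (b : A) Q c S → 2 ≤ length (P ++ b ∷ Q ++ c ∷ S)
  2≤length (_ ∷ P) b Q       c S = m≤n⇒m≤1+n (2≤length P b Q c S)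
  2≤length []      b []      c S = s≤s (s≤s z≤n)
  2≤length []      b (_ ∷ Q) c S = s≤s (s≤s z≤n)

  join-cycle : ∀ {R : A → A → Set} {a a′ b b′ c c′}
               (Wa : SimpleWalk R a a′) (Wb : SimpleWalk R b b′) (Wc : SimpleWalk R c c′) →
               R a′ b → R b′ c → R c′ a →
               Disjoint (vertices Wa) (vertices Wb ++ vertices Wc) → Disjoint (vertices Wb) (vertices Wc) →
               IsCycle R a (next Wa ++ b ∷ next Wb ++ c ∷ next Wc)
  join-cycle {R} {a} {b = b} {c = c} Wa Wb Wc a′b b′c c′a ab#c b#c = record
    { linked = Linked-++⁺ a (next Wa) b _ (linked Wa) (subst (λ t → R t b) (sym (lastIs Wa)) a′b)
                 (Linked-++⁺ b (next Wb) c _ (linked Wb) (subst (λ t → R t c) (sym (lastIs Wb)) b′c)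
                   (linked Wc))
    ; unique = Unique.++⁺ (unique Wa) (Unique.++⁺ (unique Wb) (unique Wc) b#c) ab#c
    ; closed = subst (λ t → R t a)
                 (sym (trans (lastOf-++ a (next Wa) b _) (trans (lastOf-++ b (next Wb) c _) (lastIs Wc))))
                 c′a
    ; long   = 2≤length (next Wa) b (next Wb) c (next Wc)
    }

  ¬injective-into-shorter : ∀ {m} (f : ℕ → A) → (∀ {i j} → f i ≡ f j → i ≡ j) →
                            (S : List A) → length S < m → ¬ (∀ t → t < m → f t ∈ S)
  ¬injective-into-shorter f f-inj S short f∈S
    with i , j , i<j , same-index ← pigeonhole short (λ i → index (f∈S (toℕ i) (toℕ<n i))) =
    Fin.<-irrefl (toℕ-injective (f-inj f[i]≡f[j])) i<j
    where
      f[i]≡f[j] : f (toℕ i) ≡ f (toℕ j)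
      f[i]≡f[j] = trans (lookup-index (f∈S (toℕ i) (toℕ<n i)))
                    (trans (cong (lookup S) same-index) (sym (lookup-index (f∈S (toℕ j) (toℕ<n j)))))

module _ {P : ℕ → Set} {b : ℕ} (up : ∀ {t} → suc t < b → P t → P (suc t))
         (down : ∀ {t} → suc t < b → P (suc t) → P t) where

  spread-below : ∀ {j} → j < b → P j → ∀ {t} → t < b → P t
  spread-below {j} j<b Pj {t} t<b = from-zero t t<b (to-zero j j<b Pj)
    where
      to-zero : ∀ j → j < b → P j → P 0
      to-zero zero    _   Pj = Pj
      to-zero (suc j) j<b Pj = to-zero j (<-trans (n<1+n j) j<b) (down j<b Pj)
      from-zero : ∀ t → t < b → P 0 → P t
      from-zero zero    _   P0 = P0
      from-zero (suc t) t<b P0 = up t<b (from-zero t (<-trans (n<1+n t) t<b) P0)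

module _ {k : ℕ} {H G : Graph} (_≟_ : DecidableEquality (Graph.V G)) (minor : BoundedMinor k H G) where
  private
    module H = Graph H
    module G = Graph G
  open BoundedMinor minor

  branch-walk : ∀ x {u v} → u ∈ B x → v ∈ B x → Σ (SimpleWalk G.E u v) λ W → All (_∈ B x) (vertices W)
  branch-walk x {u} {v} u∈ v∈ with u ≟ v
  ... | yes refl = simpleWalk [] [-] ([] ∷ []) refl , u∈ ∷ []
  ... | no u≢v with I , l , U ← connected x u v u∈ v∈ u≢v =
    simpleWalk (I ++ [ v ]) (Linked.map proj₁ l) U (lastOf-++ u I v []) , within u∈ l
    where
      within : ∀ {w ws} → w ∈ B x → Linked (λ a b → G.E a b × a ∈ B x × b ∈ B x) (w ∷ ws) →
               All (_∈ B x) (w ∷ ws)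
      within w∈ [-]                  = w∈ ∷ []
      within w∈ ((_ , _ , w′∈) ∷ l) = w∈ ∷ within w′∈ l

  branch-sets-disjoint : ∀ {x y} → x ≢ y → ∀ {us vs} → All (_∈ B x) us → All (_∈ B y) vs →
                         Disjoint us vs
  branch-sets-disjoint x≢y Us Vs (v∈us , v∈vs) =
    disjoint _ _ x≢y _ (All.lookup Us v∈us) (All.lookup Vs v∈vs)

  triangle⇒cycle : ∀ {x y z} → x ≢ y → y ≢ z → z ≢ x → H.E x y → H.E y z → H.E z x →
                   Σ G.V λ v → Σ (List G.V) λ vs → IsCycle G.E v vs × All (_∈ B x ++ B y ++ B z) (v ∷ vs)
  triangle⇒cycle {x} {y} {z} x≢y y≢z z≢x xy yz zx
    with a  , b  , a∈  , b∈  , ab   ← edges x y xy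
       | b′ , c  , b′∈ , c∈  , b′c  ← edges y z yz
       | c′ , a′ , c′∈ , a′∈ , c′a′ ← edges z x zx
    with Wy , Wy⊆ ← branch-walk y b∈ b′∈
       | Wz , Wz⊆ ← branch-walk z c∈ c′∈
       | Wx , Wx⊆ ← branch-walk x a′∈ a∈ =
    b , next Wy ++ c ∷ next Wz ++ a′ ∷ next Wx ,
    join-cycle Wy Wz Wx b′c c′a′ ab y#zx z#x ,
    All.++⁺ (All.map (∈-++⁺ʳ (B x) ∘ ∈-++⁺ˡ) Wy⊆)
      (All.++⁺ (All.map (∈-++⁺ʳ (B x) ∘ ∈-++⁺ʳ (B y)) Wz⊆) (All.map ∈-++⁺ˡ Wx⊆))
    where
      z#x : Disjoint (vertices Wz) (vertices Wx)
      z#x = branch-sets-disjoint z≢x Wz⊆ Wx⊆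
      y#zx : Disjoint (vertices Wy) (vertices Wz ++ vertices Wx)
      y#zx (v∈y , v∈zx) with ∈-++⁻ (vertices Wz) v∈zx
      ... | inj₁ v∈z = branch-sets-disjoint y≢z Wy⊆ Wz⊆ (v∈y , v∈z)
      ... | inj₂ v∈x = branch-sets-disjoint (x≢y ∘ sym) Wy⊆ Wx⊆ (v∈y , v∈x)

module Uniform (n : ℕ) where

  N : ℕ
  N = suc (suc n)

  open GHF (λ _ → N)

  params : GHFParams
  params = record { L = λ _ → N ; base = s≤s z≤n ; step = λ _ _ _ → s≤s (s≤s z≤n) }

  G : Graph
  G = GHFGraph params

  open Graph G using (V; E)

  depth : GV → ℕ
  depth gleft         = 0
  depth gright        = 0
  depth (ginner a _)  = suc (length a)

  ValidA-irrelevant : ∀ a (p q : ValidA a) → p ≡ q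
  ValidA-irrelevant []      _        _        = refl
  ValidA-irrelevant (i ∷ a) (p₁ , p₂) (q₁ , q₂) =
    cong₂ _,_ (<-irrelevant p₁ q₁) (ValidA-irrelevant a p₂ q₂)

  ValidV-irrelevant : ∀ x (p q : ValidV x) → p ≡ q
  ValidV-irrelevant gleft        _        _        = refl
  ValidV-irrelevant gright       _        _        = refl
  ValidV-irrelevant (ginner a j) (p₁ , p₂) (q₁ , q₂) =
    cong₂ _,_ (ValidA-irrelevant a p₁ q₁) (<-irrelevant p₂ q₂)

  vertex-≡ : ∀ {x y : V} → proj₁ x ≡ proj₁ y → x ≡ y
  vertex-≡ {x , p} {_ , q} refl = cong (x ,_) (ValidV-irrelevant x p q)

  ginner-injective : ∀ {a b i j} → ginner a i ≡ ginner b j → a ≡ b × i ≡ j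
  ginner-injective refl = refl , refl

  _≟GV_ : DecidableEquality GV
  gleft      ≟GV gleft      = yes refl
  gleft      ≟GV gright     = no λ ()
  gleft      ≟GV ginner _ _ = no λ ()
  gright     ≟GV gleft      = no λ ()
  gright     ≟GV gright     = yes refl
  gright     ≟GV ginner _ _ = no λ ()
  ginner _ _ ≟GV gleft      = no λ ()
  ginner _ _ ≟GV gright     = no λ ()
  ginner a i ≟GV ginner b j with ≡-dec ℕ._≟_ a b | i ℕ.≟ j
  ... | yes refl | yes refl = yes refl
  ... | no a≢b   | _        = no (a≢b ∘ proj₁ ∘ ginner-injective)
  ... | _        | no i≢j   = no (i≢j ∘ proj₂ ∘ ginner-injective)

  _≟V_ : DecidableEquality V
  x ≟V y = Dec.map′ vertex-≡ (cong proj₁) (proj₁ x ≟GV proj₁ y)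

  pt-end : ∀ a j → suc j ≡ N → pt a (suc j) ≡ proj₂ (ends a)
  pt-end a j j+1≡N =
    cong (λ b → if b then proj₂ (ends a) else ginner a j) (dec-true (suc j ℕ.≟ N) j+1≡N)

  pt-not-end : ∀ a j → suc j ≢ N → pt a (suc j) ≡ ginner a j
  pt-not-end a j j+1≢N =
    cong (λ b → if b then proj₂ (ends a) else ginner a j) (dec-false (suc j ℕ.≟ N) j+1≢N)

  pt-N : ∀ a → pt a N ≡ proj₂ (ends a)
  pt-N a = pt-end a (suc n) refl

  pt-inner : ∀ a j → suc j < N → pt a (suc j) ≡ ginner a j
  pt-inner a j j+1<N = pt-not-end a j (<⇒≢ j+1<N)

  OnEdge : List ℕ → GV → Set
  OnEdge b x = x ≡ proj₁ (ends b) ⊎ x ≡ proj₂ (ends b)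

  pt-view : ∀ a i → OnEdge a (pt a i) ⊎ ∃ λ j → suc j ≢ N × pt a i ≡ ginner a j
  pt-view a zero = inj₁ (inj₁ refl)
  pt-view a (suc j) with suc j ℕ.≟ N
  ... | yes j+1≡N = inj₁ (inj₂ (pt-end a j j+1≡N))
  ... | no j+1≢N  = inj₂ (j , j+1≢N , pt-not-end a j j+1≢N)

  mutual
    depth-on-edge : ∀ b {x} → OnEdge b x → depth x ≤ length b
    depth-on-edge []      (inj₁ refl) = z≤n
    depth-on-edge []      (inj₂ refl) = z≤n
    depth-on-edge (i ∷ a) (inj₁ refl) = depth-pt a i
    depth-on-edge (i ∷ a) (inj₂ refl) = depth-pt a (suc i)

    depth-pt : ∀ a i → depth (pt a i) ≤ suc (length a)
    depth-pt a i with pt-view a i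
    ... | inj₁ on-a           = m≤n⇒m≤1+n (depth-on-edge a on-a)
    ... | inj₂ (_ , _ , pt≡) = ≤-reflexive (cong depth pt≡)

  edge-has-deep-end : ∀ a i → i < N →
                      depth (pt a i) ≡ suc (length a) ⊎ depth (pt a (suc i)) ≡ suc (length a)
  edge-has-deep-end a zero    _     = inj₂ (cong depth (pt-inner a 0 (s≤s (s≤s z≤n))))
  edge-has-deep-end a (suc j) j+1<N = inj₁ (cong depth (pt-inner a j j+1<N))

  _~_ : GV → GV → Set
  x ~ y = Σ (List ℕ) λ a → a ≢ [] × ValidA a × (ends a ≡ (x , y) ⊎ ends a ≡ (y , x))

  ~-sym : ∀ {x y} → x ~ y → y ~ x
  ~-sym (a , a≢[] , va , inj₁ e) = a , a≢[] , va , inj₂ e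
  ~-sym (a , a≢[] , va , inj₂ e) = a , a≢[] , va , inj₁ e

  ~-on-edge : ∀ {x y} (e : x ~ y) → OnEdge (proj₁ e) x × OnEdge (proj₁ e) y
  ~-on-edge (_ , _ , _ , inj₁ e) = inj₁ (sym (cong proj₁ e)) , inj₂ (sym (cong proj₂ e))
  ~-on-edge (_ , _ , _ , inj₂ e) = inj₂ (sym (cong proj₂ e)) , inj₁ (sym (cong proj₁ e))

  mutual
    on-edge-ginner⇒extends : ∀ b {s j} → OnEdge b (ginner s j) → ∃₂ λ t i → b ≡ t ++ i ∷ s
    on-edge-ginner⇒extends []      (inj₁ ())
    on-edge-ginner⇒extends []      (inj₂ ())
    on-edge-ginner⇒extends (i ∷ a) (inj₁ e) = pt-ginner⇒extends a i e
    on-edge-ginner⇒extends (i ∷ a) (inj₂ e) = pt-ginner⇒extends a (suc i) e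

    pt-ginner⇒extends : ∀ a {i′} i {s j} → ginner s j ≡ pt a i →
                        ∃₂ λ t i″ → i′ ∷ a ≡ t ++ i″ ∷ s
    pt-ginner⇒extends a {i′} i e with pt-view a i
    ... | inj₁ on-a with t , i″ , refl ← on-edge-ginner⇒extends a (subst (OnEdge a) (sym e) on-a) =
      i′ ∷ t , i″ , refl
    ... | inj₂ (_ , _ , pt≡) with refl , _ ← ginner-injective (trans e pt≡) = [] , i′ , refl

  -- Addresses are reversed, so the edges c ++ r are those created inside the path added on r.
  Below : List ℕ → GV → Set
  Below r x = ∃₂ λ c j → x ≡ ginner (c ++ r) j

  Below⇒deeper : ∀ r {x} → Below r x → length r < depth x
  Below⇒deeper r (c , _ , refl) =
    s≤s (≤-trans (m≤n+m (length r) (length c)) (≤-reflexive (sym (length-++ c))))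

  mutual
    on-extension : ∀ c r {x} → OnEdge (c ++ r) x → OnEdge r x ⊎ Below r x
    on-extension []      r on          = inj₁ on
    on-extension (i ∷ c) r (inj₁ refl) = pt-on-extension c r i
    on-extension (i ∷ c) r (inj₂ refl) = pt-on-extension c r (suc i)

    pt-on-extension : ∀ c r i → OnEdge r (pt (c ++ r) i) ⊎ Below r (pt (c ++ r) i)
    pt-on-extension c r i with pt-view (c ++ r) i
    ... | inj₁ on            = on-extension c r on
    ... | inj₂ (j , _ , pt≡) = inj₂ (c , j , pt≡)

  Below-closed : ∀ r {x y} → Below r x → x ~ y → OnEdge r y ⊎ Below r y
  Below-closed r (c , j , refl) e
    with on-x , on-y ← ~-on-edge e
    with t , i , eq ← on-edge-ginner⇒extends (proj₁ e) on-x =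
    on-extension (t ++ i ∷ c) r (subst (λ b → OnEdge b _) (trans eq (sym (++-assoc t (i ∷ c) r))) on-y)

  ¬both-ends-shallow : ∀ b i → i < N → depth (pt b i) ≤ length b → depth (pt b (suc i)) ≤ length b → ⊥
  ¬both-ends-shallow b i i<N dx dy with edge-has-deep-end b i i<N
  ... | inj₁ d≡ = 1+n≰n (subst (_≤ length b) d≡ dx)
  ... | inj₂ d≡ = 1+n≰n (subst (_≤ length b) d≡ dy)

  shallow-ends-equal : ∀ i b → i < N → ∀ {x y} → OnEdge (i ∷ b) x → OnEdge (i ∷ b) y →
                       depth x ≤ length b → depth y ≤ length b → x ≡ y
  shallow-ends-equal i b _   (inj₁ refl) (inj₁ refl) _  _  = refl
  shallow-ends-equal i b _   (inj₂ refl) (inj₂ refl) _  _  = refl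
  shallow-ends-equal i b i<N (inj₁ refl) (inj₂ refl) dx dy = ⊥-elim (¬both-ends-shallow b i i<N dx dy)
  shallow-ends-equal i b i<N (inj₂ refl) (inj₁ refl) dx dy = ⊥-elim (¬both-ends-shallow b i i<N dy dx)

  ValidA-++⁻ʳ : ∀ c r → ValidA (c ++ r) → ValidA r
  ValidA-++⁻ʳ []      r v       = v
  ValidA-++⁻ʳ (i ∷ c) r (_ , v) = ValidA-++⁻ʳ c r v

  suffix-of-length : ∀ m (b : List ℕ) → m ≤ length b → ∃₂ λ c r → b ≡ c ++ r × length r ≡ m
  suffix-of-length m b m≤b =
    take (length b ∸ m) b , drop (length b ∸ m) b ,
    sym (take++drop≡id (length b ∸ m) b) , trans (length-drop (length b ∸ m) b) (m∸[m∸n]≡n m≤b)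

  leave-Below : ∀ r {x v : V} zs → Below r (proj₁ x) → Linked E (x ∷ zs ++ [ v ]) →
                All (λ z → length r < depth (proj₁ z)) zs → depth (proj₁ v) ≤ length r →
                OnEdge r (proj₁ v)
  leave-Below r []       below (e ∷ _) [] v-shallow with Below-closed r below e
  ... | inj₁ on     = on
  ... | inj₂ below′ = ⊥-elim (<⇒≱ (Below⇒deeper r below′) v-shallow)
  leave-Below r (z ∷ zs) below (e ∷ l) (z-deep ∷ deep) v-shallow with Below-closed r below e
  ... | inj₁ on     = ⊥-elim (<⇒≱ z-deep (depth-on-edge r on))
  ... | inj₂ below′ = leave-Below r zs below′ l deep v-shallow

  -- A path through vertices deeper than D + 1 enters and leaves the region below some edge
  -- r of length D + 1; but r has only one end of depth at most D.
  ¬deep-interior : ∀ D {u v : V} w I → depth (proj₁ u) ≤ D → depth (proj₁ v) ≤ D →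
                   Linked E (u ∷ (w ∷ I) ++ [ v ]) → Unique (u ∷ (w ∷ I) ++ [ v ]) →
                   All (λ z → suc D < depth (proj₁ z)) (w ∷ I) → ⊥
  ¬deep-interior D (gleft  , _) I _ _ _ _ (() ∷ _)
  ¬deep-interior D (gright , _) I _ _ _ _ (() ∷ _)
  ¬deep-interior D {u} {v} (ginner b j , vb , _) I du dv (e ∷ l) (u∉ ∷ _) (w-deep ∷ deep)
    with suffix-of-length (suc D) b (≤-pred w-deep)
  ... | c , i ∷ b′ , refl , refl = All.lookup u∉ (∈-++⁺ʳ (_ ∷ I) (here refl)) (vertex-≡ u≡v)
    where
      r : List ℕ
      r = i ∷ b′
      w-below : Below r (ginner (c ++ r) j)
      w-below = c , j , refl
      u-on-r : OnEdge r (proj₁ u)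
      u-on-r with Below-closed r w-below (~-sym e)
      ... | inj₁ on     = on
      ... | inj₂ below′ = ⊥-elim (<⇒≱ (Below⇒deeper r below′) (m≤n⇒m≤1+n du))
      u≡v : proj₁ u ≡ proj₁ v
      u≡v = shallow-ends-equal i b′ (proj₁ (ValidA-++⁻ʳ c r vb)) u-on-r
              (leave-Below r I w-below l deep (m≤n⇒m≤1+n dv)) du dv

  addresses : ℕ → List (List ℕ)
  addresses zero    = []
  addresses (suc m) = [] ∷ concatMap (λ i → map (i ∷_) (addresses m)) (upTo N)

  addresses-complete : ∀ m s → ValidA s → length s < m → s ∈ addresses m
  addresses-complete (suc m) []      _          _            = here refl
  addresses-complete (suc m) (i ∷ s) (i<N , vs) (s≤s s<m) =
    there (∈-concatMap⁺ (λ i → map (i ∷_) (addresses m))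
      (Any.map (λ { refl → ∈-map⁺ (i ∷_) (addresses-complete m s vs s<m) }) (∈-upTo⁺ i<N)))

  shallow-vertices : ℕ → List GV
  shallow-vertices m = gleft ∷ gright ∷ concatMap (λ s → map (ginner s) (upTo N)) (addresses m)

  shallow-vertices-complete : ∀ m (x : V) → depth (proj₁ x) ≤ m → proj₁ x ∈ shallow-vertices m
  shallow-vertices-complete m (gleft  , _) _ = here refl
  shallow-vertices-complete m (gright , _) _ = there (here refl)
  shallow-vertices-complete m (ginner s j , vs , j+1<N) s<m =
    there (there (∈-concatMap⁺ (λ s → map (ginner s) (upTo N))
      (Any.map (λ { refl → ∈-map⁺ (ginner s) (∈-upTo⁺ (<-trans (n<1+n j) j+1<N)) })
        (addresses-complete m s vs s<m))))

  -- Each path of the family is sent to an interior vertex of depth at most D + 1, or to nothing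
  -- when its interior is empty; independence makes this injective, but its range is finite.
  ¬infinitely-many-independent-paths : ¬ (Σ V λ u → Σ V λ v → InfIndepPaths G u v)
  ¬infinitely-many-independent-paths (u , v , path , distinct , independent) =
    finite (mk↣ {to = label} label-injective) (nothing ∷ map just (shallow-vertices (suc D))) label∈
    where
      D : ℕ
      D = depth (proj₁ u) + depth (proj₁ v)

      Shallow : V → Set
      Shallow x = depth (proj₁ x) ≤ suc D

      interior : ℕ → List V
      interior i = proj₁ (path i)

      shallow-vertex : ∀ {I} → Dec (Any Shallow I) → Maybe GV
      shallow-vertex (yes s) = just (proj₁ (proj₁ (find s)))
      shallow-vertex (no _)  = nothing

      shallow? : ∀ I → Dec (Any Shallow I)
      shallow? = any? (λ x → depth (proj₁ x) ℕ.≤? suc D)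

      label : ℕ → Maybe GV
      label i = shallow-vertex (shallow? (interior i))

      interior-empty : ∀ i → ¬ Any Shallow (interior i) → interior i ≡ []
      interior-empty i no-shallow with path i
      ... | [] , _ = refl
      ... | w ∷ I , l , U = ⊥-elim (¬deep-interior D w I (m≤m+n _ _) (m≤n+m _ _) l U
                              (All.map ≰⇒> (¬Any⇒All¬ (w ∷ I) no-shallow)))

      labels-injective : ∀ i j (si : Dec (Any Shallow (interior i))) (sj : Dec (Any Shallow (interior j))) →
                         shallow-vertex si ≡ shallow-vertex sj → i ≡ j
      labels-injective i j (yes si) (yes sj) x≡y with i ℕ.≟ j
      ... | yes i≡j = i≡j
      ... | no i≢j  with x , x∈ , _ ← find si | y , y∈ , _ ← find sj =
        ⊥-elim (independent i j i≢j x x∈ (subst (_∈ interior j) (sym (vertex-≡ (just-injective x≡y))) y∈))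
      labels-injective i j (yes _) (no _) ()
      labels-injective i j (no _) (yes _) ()
      labels-injective i j (no si) (no sj) _ =
        distinct i j (trans (interior-empty i si) (sym (interior-empty j sj)))

      label-injective : ∀ {i j} → label i ≡ label j → i ≡ j
      label-injective {i} {j} = labels-injective i j (shallow? (interior i)) (shallow? (interior j))

      label∈ : ∀ i → label i ∈ nothing ∷ map just (shallow-vertices (suc D))
      label∈ i with shallow? (interior i)
      ... | yes s with x , _ , x-shallow ← find s =
        there (∈-map⁺ just (shallow-vertices-complete (suc D) x x-shallow))
      ... | no _ = here refl

  mutual
    ends-valid : ∀ a → ValidA a → ValidV (proj₁ (ends a)) × ValidV (proj₂ (ends a))
    ends-valid []      _          = _ , _
    ends-valid (i ∷ a) (i<N , va) = pt-valid a va i (<⇒≤ i<N) , pt-valid a va (suc i) i<N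

    pt-valid : ∀ a → ValidA a → ∀ i → i ≤ N → ValidV (pt a i)
    pt-valid a va zero    _     = proj₁ (ends-valid a va)
    pt-valid a va (suc j) j+1≤N with suc j ℕ.≟ N
    ... | yes j+1≡N = subst ValidV (sym (pt-end a j j+1≡N)) (proj₂ (ends-valid a va))
    ... | no j+1≢N  = subst ValidV (sym (pt-not-end a j j+1≢N)) (va , ≤∧≢⇒< j+1≤N j+1≢N)

  along-path : ∀ {R : GV → GV → Set} a → (∀ t → t < N → Star R (pt a t) (pt a (suc t))) →
               ∀ d → d ≤ N → Star R (pt a 0) (pt a d)
  along-path a step zero    _     = ε
  along-path a step (suc d) d+1≤N = along-path a step d (<⇒≤ d+1≤N) ◅◅ step d d+1≤N

  -- These survive the deletion of any edges between vertices of depth at most M.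
  DeepEdge : ℕ → GV → GV → Set
  DeepEdge M x y = ValidV x × ValidV y × x ~ y × (M < depth x ⊎ M < depth y)

  DeepEdge-sym : ∀ {M x y} → DeepEdge M x y → DeepEdge M y x
  DeepEdge-sym (vx , vy , e , deep) = vy , vx , ~-sym e , Sum.swap deep

  module _ (M : ℕ) where

    path-edge-deep : ∀ a → ValidA a → ∀ t → t < N → M ≤ length a → DeepEdge M (pt a t) (pt a (suc t))
    path-edge-deep a va t t<N M≤a =
      pt-valid a va t (<⇒≤ t<N) , pt-valid a va (suc t) t<N , (t ∷ a , (λ ()) , (t<N , va) , inj₁ refl) ,
      Sum.map deeper deeper (edge-has-deep-end a t t<N)
      where
        deeper : ∀ {x} → depth x ≡ suc (length a) → M < depth x
        deeper d≡ = subst (M <_) (sym d≡) (s≤s M≤a)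

    -- Edge t ∷ a of the path added on a is deep once a is long; otherwise replace it by the
    -- path added on it.  The fuel m bounds how often this happens.
    ends-joined : ∀ m a → ValidA a → M ≤ length a + m → Star (DeepEdge M) (pt a 0) (proj₂ (ends a))
    ends-joined zero a va M≤ = subst (Star (DeepEdge M) _) (pt-N a) (along-path a
      (λ t t<N → path-edge-deep a va t t<N (subst (M ≤_) (+-identityʳ _) M≤) ◅ ε) N ≤-refl)
    ends-joined (suc m) a va M≤ = subst (Star (DeepEdge M) _) (pt-N a) (along-path a
      (λ t t<N → ends-joined m (t ∷ a) (t<N , va) (subst (M ≤_) (+-suc _ m) M≤)) N ≤-refl)

    prefix-joined : ∀ a → ValidA a → ∀ i → i ≤ N → Star (DeepEdge M) (pt a 0) (pt a i)
    prefix-joined a va = along-path a (λ t t<N → ends-joined M (t ∷ a) (t<N , va) (m≤n+m M _))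

    gleft-joined-pt : ∀ a → ValidA a → ∀ i → i ≤ N → Star (DeepEdge M) gleft (pt a i)
    gleft-joined-pt []      va         = prefix-joined [] va
    gleft-joined-pt (s ∷ a) (s<N , va) i i≤N =
      gleft-joined-pt a va s (<⇒≤ s<N) ◅◅ prefix-joined (s ∷ a) (s<N , va) i i≤N

    gleft-joined : ∀ (x : V) → Star (DeepEdge M) gleft (proj₁ x)
    gleft-joined (gleft , _)  = ε
    gleft-joined (gright , _) = subst (Star (DeepEdge M) gleft) (pt-N []) (gleft-joined-pt [] _ N ≤-refl)
    gleft-joined (ginner a j , va , j+1<N) =
      subst (Star (DeepEdge M) gleft) (pt-inner a j j+1<N) (gleft-joined-pt a va (suc j) (<⇒≤ j+1<N))

    DeepEdgeᵛ : V → V → Set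
    DeepEdgeᵛ x y = E x y × (M < depth (proj₁ x) ⊎ M < depth (proj₁ y))

    lift-walk : ∀ {x y} → Star (DeepEdge M) x y → (px : ValidV x) (py : ValidV y) →
                Star DeepEdgeᵛ (x , px) (y , py)
    lift-walk {x} ε px py = subst (λ q → Star DeepEdgeᵛ (x , px) (x , q)) (ValidV-irrelevant x px py) ε
    lift-walk ((_ , vy , e , deep) ◅ w) px py = (e , deep) ◅ lift-walk w vy py

    deeply-connected : ∀ u v → Star DeepEdgeᵛ u v
    deeply-connected (u , pu) (v , pv) =
      lift-walk (Star.reverse DeepEdge-sym (gleft-joined (u , pu)) ◅◅ gleft-joined (v , pv)) pu pv

  depth-bound : List (V × V) → ℕ
  depth-bound []            = 0
  depth-bound ((x , y) ∷ F) = depth (proj₁ x) + depth (proj₁ y) + depth-bound F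

  depth-bound-≥ : ∀ F {x y} → (x , y) ∈ F →
                  depth (proj₁ x) ≤ depth-bound F × depth (proj₁ y) ≤ depth-bound F
  depth-bound-≥ ((x , y) ∷ F) (here refl) =
    ≤-trans (m≤m+n _ _) (m≤m+n _ _) , ≤-trans (m≤n+m (depth (proj₁ y)) (depth (proj₁ x))) (m≤m+n _ _)
  depth-bound-≥ (_ ∷ F) (there xy∈F) =
    Product.map (λ le → ≤-trans le (m≤n+m _ _)) (λ le → ≤-trans le (m≤n+m _ _)) (depth-bound-≥ F xy∈F)

  DeepEdgeᵛ-avoids : ∀ F {x y} → DeepEdgeᵛ (depth-bound F) x y → EMinus G F x y
  DeepEdgeᵛ-avoids F (e , deep) = e , avoid deep , avoid (Sum.swap deep)
    where
      avoid : ∀ {x y} → depth-bound F < depth (proj₁ x) ⊎ depth-bound F < depth (proj₁ y) → (x , y) ∉ F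
      avoid (inj₁ deep) xy∈F = <⇒≱ deep (proj₁ (depth-bound-≥ F xy∈F))
      avoid (inj₂ deep) xy∈F = <⇒≱ deep (proj₂ (depth-bound-≥ F xy∈F))

  infinitely-edge-connected : InfinitelyEdgeConnected G
  infinitely-edge-connected = ((gleft , _) , (gright , _) , λ ()) , λ u v u≢v F separated →
    separated (avoiding F (SimpleWalk⇒PathIn u≢v (Star⇒SimpleWalk _≟V_ (deeply-connected (depth-bound F) u v))))
    where
      avoiding : ∀ F {u v} → PathIn (DeepEdgeᵛ (depth-bound F)) u v → PathIn (EMinus G F) u v
      avoiding F (I , l , U) = I , Linked.map (DeepEdgeᵛ-avoids F) l , U

  isΠGraph : IsΠGraph G
  isΠGraph = infinitely-edge-connected , ¬infinitely-many-independent-paths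

  -- pt a j and pt a (j + 2) are the neighbours of ginner a j = pt a (j + 1) on its own path.
  shallower-neighbour : ∀ {w p} → w ~ p → depth p ≤ depth w →
                        ∃₂ λ a j → w ≡ ginner a j × (p ≡ pt a j ⊎ p ≡ pt a (suc (suc j)))
  shallower-neighbour ([]    , []≢[] , _)                  _   = ⊥-elim ([]≢[] refl)
  shallower-neighbour (i ∷ a , _ , (i<N , _) , inj₁ refl) p≤w = forward a i i<N p≤w
    where
      forward : ∀ a i → i < N → depth (pt a (suc i)) ≤ depth (pt a i) →
                ∃₂ λ b j → pt a i ≡ ginner b j ×
                           (pt a (suc i) ≡ pt b j ⊎ pt a (suc i) ≡ pt b (suc (suc j)))
      forward a zero    _     p≤w = ⊥-elim (1+n≰n (≤-trans
        (subst (_≤ depth (pt a 0)) (cong depth (pt-inner a 0 (s≤s (s≤s z≤n)))) p≤w)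
        (depth-on-edge a (inj₁ refl))))
      forward a (suc m) m+1<N _   = a , m , pt-inner a m m+1<N , inj₂ refl
  shallower-neighbour (i ∷ a , _ , (i<N , _) , inj₂ refl) p≤w = backward a i i<N p≤w
    where
      backward : ∀ a i → i < N → depth (pt a i) ≤ depth (pt a (suc i)) →
                 ∃₂ λ b j → pt a (suc i) ≡ ginner b j × (pt a i ≡ pt b j ⊎ pt a i ≡ pt b (suc (suc j)))
      backward a zero _ _ = a , 0 , pt-inner a 0 (s≤s (s≤s z≤n)) , inj₁ refl
      backward a (suc m) m+1<N p≤w with suc (suc m) ℕ.≟ N
      ... | yes m+2≡N = ⊥-elim (1+n≰n (≤-trans (subst (_≤ depth (pt a (suc (suc m))))
                          (cong depth (pt-inner a m m+1<N)) p≤w)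
                          (depth-on-edge a (inj₂ (pt-end a (suc m) m+2≡N)))))
      ... | no m+2≢N  = a , suc m , pt-not-end a (suc m) m+2≢N , inj₁ refl

  module _ (C : List V) (two-neighbours : ∀ {y} → y ∈ C → TwoNeighboursIn E C y)
           (a : List ℕ) (maximal : ∀ {y} → y ∈ C → depth (proj₁ y) ≤ suc (length a)) where

    InC : GV → Set
    InC g = g ∈ map proj₁ C

    path-neighbours-in : ∀ t → InC (ginner a t) → InC (pt a t) × InC (pt a (suc (suc t)))
    path-neighbours-in t g∈
      with y , y∈ , g≡y ← ∈-map⁻ proj₁ g∈
      with p , q , p∈ , q∈ , p≢q , yp , yq ← two-neighbours y∈
      with beside p∈ yp | beside q∈ yq
      where
        beside : ∀ {x} → x ∈ C → E y x → proj₁ x ≡ pt a t ⊎ proj₁ x ≡ pt a (suc (suc t))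
        beside x∈ yx
          with _ , _ , y≡ , side ← shallower-neighbour yx (subst (_ ≤_) (cong depth g≡y) (maximal x∈))
          with refl , refl ← ginner-injective (trans g≡y y≡) = side
    ... | inj₁ p≡ | inj₁ q≡ = ⊥-elim (p≢q (vertex-≡ (trans p≡ (sym q≡))))
    ... | inj₂ p≡ | inj₂ q≡ = ⊥-elim (p≢q (vertex-≡ (trans p≡ (sym q≡))))
    ... | inj₁ p≡ | inj₂ q≡ = subst InC p≡ (∈-map⁺ proj₁ p∈) , subst InC q≡ (∈-map⁺ proj₁ q∈)
    ... | inj₂ p≡ | inj₁ q≡ = subst InC q≡ (∈-map⁺ proj₁ q∈) , subst InC p≡ (∈-map⁺ proj₁ p∈)

    whole-path-in : ∀ {j} → j < suc n → InC (ginner a j) → ∀ {t} → t < suc n → InC (ginner a t)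
    whole-path-in = spread-below
      (λ {t} t+1<n+1 g∈ →
        subst InC (pt-inner a (suc t) (s≤s t+1<n+1)) (proj₂ (path-neighbours-in t g∈)))
      (λ {t} t+1<n+1 g∈ →
        subst InC (pt-inner a t (m<n⇒m<1+n t+1<n+1)) (proj₁ (path-neighbours-in (suc t) g∈)))

  module _ {x xs} (cyc : IsCycle E x xs) where
    private
      f : V → ℕ
      f = depth ∘ proj₁

      w : V
      w = argmax f x xs

      w∈ : w ∈ x ∷ xs
      w∈ = argmax-all f {P = _∈ x ∷ xs} (here refl) (All.tabulate there)

      maximal : ∀ {y} → y ∈ x ∷ xs → f y ≤ f w
      maximal = All.lookup (f[⊥]≤f[argmax] {f = f} x xs ∷ f[xs]≤f[argmax] {f = f} x xs)

      two-neighbours : ∀ {y} → y ∈ x ∷ xs → TwoNeighboursIn E (x ∷ xs) y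
      two-neighbours = cycle-neighbours ~-sym cyc

    -- The deepest vertex of a cycle is inner to some added path, and the cycle must follow that path.
    cycle-covers-added-path : ∃ λ a → ∀ t → t < suc n → ginner a t ∈ map proj₁ (x ∷ xs)
    cycle-covers-added-path
      with p , _ , p∈ , _ , _ , wp , _ ← two-neighbours w∈
      with a , j , w≡ , _ ← shallower-neighbour wp (maximal p∈) =
      a , λ t → whole-path-in (x ∷ xs) two-neighbours a (subst (_ ≤_) (cong depth w≡) ∘ maximal) j<n+1 w∈C
      where
        j<n+1 : j < suc n
        j<n+1 = ≤-pred (proj₂ (subst ValidV w≡ (proj₂ w)))
        w∈C : ginner a j ∈ map proj₁ (x ∷ xs)
        w∈C = subst (_∈ map proj₁ (x ∷ xs)) w≡ (∈-map⁺ proj₁ w∈)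

  cycle-needs-many-vertices : ∀ (S : List V) → length S ≤ n →
                              ∀ {x xs} → IsCycle E x xs → All (_∈ S) (x ∷ xs) → ⊥
  cycle-needs-many-vertices S |S|≤n {x} {xs} cyc C⊆S =
    ¬injective-into-shorter (ginner (proj₁ covers)) (proj₂ ∘ ginner-injective) (map proj₁ S)
      (s≤s (≤-trans (≤-reflexive (length-map proj₁ S)) |S|≤n))
      (λ t t<n+1 → ⊆-map⁺ proj₁ (All.lookup C⊆S) (proj₂ covers t t<n+1))
    where
      covers : ∃ λ a → ∀ t → t < suc n → ginner a t ∈ map proj₁ (x ∷ xs)
      covers = cycle-covers-added-path cyc

  no-bounded-Farey-minor : ∀ {k} → 3 * k ≤ n → ¬ BoundedMinor k Farey G
  no-bounded-Farey-minor {k} 3k≤n minor =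
    let _ , _ , cycle , cycle⊆ = triangle⇒cycle _≟V_ minor {left} {right} {mf} (λ ()) (λ ()) (λ ())
                                   (false , [] , inj₁ refl) (false , true ∷ [] , inj₂ refl)
                                   (false , false ∷ [] , inj₂ refl)
    in cycle-needs-many-vertices (B left ++ B right ++ B mf) branch-sets-small cycle cycle⊆
    where
      open BoundedMinor minor
      mf : FV
      mf = mid false []
      branch-sets-small : length (B left ++ B right ++ B mf) ≤ n
      branch-sets-small = begin
        length (B left ++ B right ++ B mf)                   ≡⟨ length-++ (B left) ⟩
        length (B left) + length (B right ++ B mf)           ≡⟨ cong (length (B left) +_) (length-++ (B right)) ⟩
        length (B left) + (length (B right) + length (B mf)) ≤⟨ +-mono-≤ (size left) (+-mono-≤ (size right) (size mf)) ⟩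
        k + (k + k)                                          ≡⟨ cong (λ m → k + (k + m)) (sym (+-identityʳ k)) ⟩
        3 * k                                                ≤⟨ 3k≤n ⟩
        n                                                    ∎
        where
          open ≤-Reasoning
          size : ∀ x → length (B x) ≤ k
          size x = <⇒≤ (small x)

lemma3p14 : (k : ℕ) → Σ GHFParams λ P →
    IsΠGraph (GHFGraph P) × ¬ BoundedMinor k Farey (GHFGraph P)
lemma3p14 k = params , isΠGraph , no-bounded-Farey-minor ≤-refl
  where open Uniform (3 * k)
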